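{- Let $G=(K\cup I,E)$ be a split graph such that no vertex $i\in I$ satisfies $N(i)=K$, and let $(V,\mathcal{F})$ be the split graph shelling antimatroid built on $G$. Then the set of paths of $(V,\mathcal{F})$ equals $P=P_1\cup P_2\cup P_3$, where $$P_1=\{\{i\}: i\in I\},\quad P_2=\{\{k\}\cup(N(k)\cap I): k\in K\},$$ $$P_3=\{\operatorname{fos}(i)\cup\{k\}\cup\bigl((N(k)\cap I)\setminus\{i\}\bigr): i\in I,\ k\in N(i)\}.$$
   Context: All graphs are finite and simple. A split graph $G=(K\cup I,E)$ has vertex set $V=K\cup I$ partitioned into a clique $K$ and an independent set $I$ (either may be empty), the partition being given. For $S\subseteq V$, $N(S)$ is the set of vertices of $V\setminus S$ adjacent to some vertex of $S$; $N(v)=N(\{v\})$. A vertex is simplicial if its neighbours induce a clique. The split graph vertex shelling antimatroid $(V,\mathcal{F})$ on $G$: $F\subseteq V$ is feasible iff there is an ordering $(f_1,\dots,f_{|F|})$ of $F$ such that each $f_j$ is simplicial in $G\setminus\{f_1,\dots,f_{j-1}\}$. A path of an antimatroid is a feasible set that cannot be written as the union of two feasible sets both different from it (equivalently, a feasible set containing a unique element whose removal leaves a feasible set). For $i\in I$, $\operatorname{fos}(i)=\{k\in K: k\text{ not adjacent to } i\}\cup\{i'\in I: N(i')\not\subseteq N(i)\}$. -}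

module Defs where

open import Data.Nat using (ℕ)
open import Data.Bool using (Bool; true; false; not)
open import Data.Fin using (Fin)
open import Data.Fin.Subset using (Subset; _∈_; _∉_; _∪_; _∩_; ⁅_⁆; ∁; _⊆_; ⊥; Nonempty)
open import Data.Fin.Subset.Properties using (_⊆?_; _∈?_)
open import Data.Vec using (tabulate)
open import Data.Product using (Σ; ∃; ∃-syntax; _×_; _,_)
open import Data.Sum using (_⊎_)
open import Relation.Nullary using (¬_; Dec; yes; no)
open import Relation.Nullary.Decidable using (⌊_⌋)
open import Relation.Binary.PropositionalEquality using (_≡_; _≢_)

record SplitGraph (n : ℕ) : Set where
  field
    adj    : Fin n → Fin n → Bool
    sym    : ∀ u v → adj u v ≡ adj v u
    irrefl : ∀ v → adj v v ≡ false
    K      : Subset n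
    clique : ∀ u v → u ∈ K → v ∈ K → u ≢ v → adj u v ≡ true
    indep  : ∀ u v → u ∉ K → v ∉ K → adj u v ≡ false

  I : Subset n
  I = ∁ K

  -- N(v) (v itself excluded by irreflexivity)
  N : Fin n → Subset n
  N v = tabulate (adj v)

  _─_ : Subset n → Subset n → Subset n
  A ─ B = A ∩ ∁ B

  SimplicialIn : Subset n → Fin n → Set
  SimplicialIn S v =
    v ∉ S ×
    (∀ u w → u ∉ S → w ∉ S → adj v u ≡ true → adj v w ≡ true → u ≢ w → adj u w ≡ true)

  -- Feasible sets of the split graph vertex shelling antimatroid:
  -- F is feasible iff it can be built as f₁,…,f_m with each f_j simplicial
  -- in G \ {f₁,…,f_{j-1}} (inductive rendering of the ordering).
  data Feasible : Subset n → Set where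
    empty : Feasible ⊥
    add   : ∀ {F} v → Feasible F → SimplicialIn F v → Feasible (F ∪ ⁅ v ⁆)

  IsPath : Subset n → Set
  IsPath F = Feasible F × Nonempty F ×
    ¬ (∃[ A ] ∃[ B ] (Feasible A × Feasible B × A ≢ F × B ≢ F × A ∪ B ≡ F))

  -- fos(i) = {k ∈ K : k not adjacent to i} ∪ {i' ∈ I : N(i') ⊈ N(i)}
  fos : Fin n → Subset n
  fos i = tabulate (λ x → (Data.Bool._∧_ ⌊ x ∈? K ⌋ (not (adj i x)))
                          Data.Bool.∨ (Data.Bool._∧_ (not ⌊ x ∈? K ⌋) (not ⌊ N x ⊆? N i ⌋)))

  P₁ P₂ P₃ : Subset n → Set
  P₁ F = ∃[ i ] (i ∈ I × F ≡ ⁅ i ⁆)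
  P₂ F = ∃[ k ] (k ∈ K × F ≡ ⁅ k ⁆ ∪ (N k ∩ I))
  P₃ F = ∃[ i ] ∃[ k ] (i ∈ I × k ∈ N i ×
           F ≡ fos i ∪ ⁅ k ⁆ ∪ ((N k ∩ I) ─ ⁅ i ⁆))

  InP : Subset n → Set
  InP F = P₁ F ⊎ P₂ F ⊎ P₃ F

-- The members of P are Q₁(i) = {i}, Q₂(k) = {k} ∪ (N(k) ∩ I) and
-- Q₃(i,k) = fos(i) ∪ {k} ∪ ((N(k) ∩ I) ∖ {i}); k is the root of Q₂ and Q₃.
--
-- Key fact (absorption): if a root x is simplicial after shelling a feasible
-- S, then the relevant member of P rooted at x already lies in S ∪ {x}
-- (Q₂-absorbed, where the hypothesis N(i) ≠ K is used, and Q₃-absorbed).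
--  * P ⊆ paths: members of P are feasible (shell independent vertices, then
--    clique vertices with no unshelled independent neighbour, then the
--    root); by absorption every feasible subset containing the root is the
--    whole set, so the set is not a union of two smaller feasible sets
--    (path-criterion).
--  * paths ⊆ P: a path F arises as F' ∪ {x} with x simplicial after F';
--    absorption yields Q ∈ P with x ∈ Q ⊆ F (P-member-below), and Q ∪ F' = F
--    forces Q = F (path-last-step).

module Submission where

open import Defs
open import Data.Nat using (ℕ)
open import Data.Fin.Subset using (_∈_)
open import Data.Product using (_×_)
open import Relation.Binary.PropositionalEquality using (_≢_)

open import Function using (id; _∘_)
open import Data.Bool using (Bool; true; false; not; _∧_; _∨_)
open import Data.Bool.Properties using (¬-not)
import Data.Bool.Properties as Bool
open import Data.Fin using (Fin; _≟_)
open import Data.Fin.Properties using (¬∀⟶∃¬; any?)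
open import Data.Fin.Subset using (Subset; _∉_; _∪_; _∩_; ⁅_⁆; ∁; _⊆_; _⊈_; ⊥)
open import Data.Fin.Subset.Properties
  using (_⊆?_; _∈?_; ∉⊥; x∈⁅x⁆; x∈⁅y⁆⇒x≡y; ⊆-antisym; ⊆-refl; p⊆p∪q; q⊆p∪q;
         x∈p∪q⁻; x∈p∪q⁺; x∈p∩q⁺; x∈p∩q⁻; p∩q⊆p; p∩q⊆q; x∈∁p⇒x∉p; x∉p⇒x∈∁p;
         ∪-identityˡ; ∪-comm)
open import Data.Vec using (tabulate)
open import Data.Vec.Properties using (lookup∘tabulate; []=⇒lookup; lookup⇒[]=; ≡-dec)
open import Data.Product using (∃-syntax; _,_; proj₁; proj₂)
open import Data.Sum using (_⊎_; inj₁; inj₂)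
open import Data.Empty using (⊥-elim)
open import Data.List using (List; []; _∷_; allFin)
open import Data.List.Relation.Unary.Any using (here; there)
open import Data.List.Membership.Propositional renaming (_∈_ to _∈ₗ_) using ()
open import Data.List.Membership.Propositional.Properties using (∈-allFin)
open import Relation.Nullary using (¬_; Dec; yes; no)
open import Relation.Nullary.Decidable using (⌊_⌋; decidable-stable; _→-dec_; _×-dec_; ¬?)
open import Relation.Binary.PropositionalEquality using (_≡_; refl; sym; trans; subst)

module _ {n : ℕ} where

  ∈-tabulate⁻ : ∀ {f : Fin n → Bool} {x} → x ∈ tabulate f → f x ≡ true
  ∈-tabulate⁻ {f} {x} x∈ = trans (sym (lookup∘tabulate f x)) ([]=⇒lookup x∈)

  ∈-tabulate⁺ : ∀ {f : Fin n → Bool} {x} → f x ≡ true → x ∈ tabulate f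
  ∈-tabulate⁺ {f} {x} fx = lookup⇒[]= x (tabulate f) (trans (lookup∘tabulate f x) fx)

  ∈-stable : ∀ {x} {p : Subset n} → ¬ (x ∉ p) → x ∈ p
  ∈-stable {x} {p} = decidable-stable (x ∈? p)

  ∪-least : ∀ {p q r : Subset n} → p ⊆ r → q ⊆ r → p ∪ q ⊆ r
  ∪-least {p} {q} p⊆r q⊆r x∈ with x∈p∪q⁻ p q x∈
  ... | inj₁ x∈p = p⊆r x∈p
  ... | inj₂ x∈q = q⊆r x∈q

  singleton⊆ : ∀ {x} {p : Subset n} → x ∈ p → ⁅ x ⁆ ⊆ p
  singleton⊆ {x} x∈p y∈ = subst (_∈ _) (sym (x∈⁅y⁆⇒x≡y x y∈)) x∈p

  ⊈-witness : ∀ {p q : Subset n} → p ⊈ q → ∃[ x ] (x ∈ p × x ∉ q)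
  ⊈-witness {p} {q} p⊈q
    with ¬∀⟶∃¬ n (λ y → y ∈ p → y ∈ q) (λ y → (y ∈? p) →-dec (y ∈? q)) (λ f → p⊈q (f _))
  ... | x , ¬imp = x , ∈-stable (λ x∉p → ¬imp (⊥-elim ∘ x∉p)) , ¬imp ∘ (λ x∈q _ → x∈q)

module Shelling {n : ℕ} (G : SplitGraph n) where
  open SplitGraph G renaming (sym to adj-sym)

  _~_ : Fin n → Fin n → Set
  u ~ v = adj u v ≡ true

  ~-sym : ∀ {u v} → u ~ v → v ~ u
  ~-sym {u} {v} u~v = trans (adj-sym v u) u~v

  false⇒≁ : ∀ {u v} → adj u v ≡ false → ¬ u ~ v
  false⇒≁ adj≡false u~v with trans (sym u~v) adj≡false
  ... | ()

  ∈N⁻ : ∀ {v x} → x ∈ N v → v ~ x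
  ∈N⁻ = ∈-tabulate⁻

  ∈N⁺ : ∀ {v x} → v ~ x → x ∈ N v
  ∈N⁺ = ∈-tabulate⁺

  K≢I : ∀ {u v} → u ∈ K → v ∉ K → u ≢ v
  K≢I u∈K v∉K refl = v∉K u∈K

  I-nonadjacent : ∀ {u v} → u ∉ K → v ∉ K → ¬ u ~ v
  I-nonadjacent {u} {v} u∉K v∉K = false⇒≁ (indep u v u∉K v∉K)

  I-neighbour∈K : ∀ {u v} → u ∉ K → u ~ v → v ∈ K
  I-neighbour∈K u∉K u~v = ∈-stable (λ v∉K → I-nonadjacent u∉K v∉K u~v)

  shelling-stage : ∀ {A} → Feasible A → ∀ {v} → v ∈ A →
                   ∃[ S ] (Feasible S × S ⊆ A × SimplicialIn S v)
  shelling-stage empty v∈ = ⊥-elim (∉⊥ v∈)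
  shelling-stage (add {F} u fF simp) {v} v∈ with x∈p∪q⁻ F ⁅ u ⁆ v∈
  ... | inj₁ v∈F with shelling-stage fF v∈F
  ...   | S , fS , S⊆F , simpS = S , fS , p⊆p∪q ⁅ u ⁆ ∘ S⊆F , simpS
  shelling-stage (add {F} u fF simp) {v} v∈ | inj₂ v∈⁅u⁆ with x∈⁅y⁆⇒x≡y u v∈⁅u⁆
  ... | refl = F , fF , p⊆p∪q ⁅ u ⁆ , simp

  OuterInK : Subset n → Fin n → Set
  OuterInK F v = ∀ {u} → v ~ u → u ∉ F → u ∈ K

  outerInK⇒simplicial : ∀ {F T v} → F ⊆ T → OuterInK F v → v ∉ T → SimplicialIn T v
  outerInK⇒simplicial F⊆T out v∉T = v∉T , λ u w u∉T w∉T v~u v~w u≢w →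
    clique u w (out v~u (u∉T ∘ F⊆T)) (out v~w (w∉T ∘ F⊆T)) u≢w

  -- A feasible F can be extended by any X all of whose members have only
  -- clique neighbours outside F: shell the members of X in any order.
  extend : ∀ {F} X → Feasible F → (∀ {v} → v ∈ X → OuterInK F v) → Feasible (F ∪ X)
  extend {F} X fF out with grow (allFin n)
    where
    grow : (L : List (Fin n)) →
           ∃[ S ] (Feasible S × F ⊆ S × S ⊆ F ∪ X × (∀ {x} → x ∈ₗ L → x ∈ X → x ∈ S))
    grow [] = F , fF , id , p⊆p∪q X , λ ()
    grow (v ∷ L) with grow L
    ... | S , fS , F⊆S , S⊆ , L⊆S with v ∈? X | v ∈? S
    ...   | yes v∈X | no v∉S = S ∪ ⁅ v ⁆ ,
            add v fS (outerInK⇒simplicial F⊆S (out v∈X) v∉S) ,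
            p⊆p∪q ⁅ v ⁆ ∘ F⊆S ,
            ∪-least S⊆ (singleton⊆ (q⊆p∪q F X v∈X)) ,
            λ { (here refl) _     → q⊆p∪q S ⁅ v ⁆ (x∈⁅x⁆ v)
              ; (there x∈L) x∈X → p⊆p∪q ⁅ v ⁆ (L⊆S x∈L x∈X) }
    ...   | yes _ | yes v∈S = S , fS , F⊆S , S⊆ ,
            λ { (here refl) _ → v∈S ; (there x∈L) x∈X → L⊆S x∈L x∈X }
    ...   | no v∉X | _ = S , fS , F⊆S , S⊆ ,
            λ { (here refl) v∈X → ⊥-elim (v∉X v∈X) ; (there x∈L) x∈X → L⊆S x∈L x∈X }
  ... | S , fS , F⊆S , S⊆ , L⊆S =
    subst Feasible (⊆-antisym S⊆ (∪-least F⊆S (λ {x} → L⊆S (∈-allFin x)))) fS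

  independent-feasible : ∀ {X} → X ⊆ I → Feasible X
  independent-feasible {X} X⊆I = subst Feasible (∪-identityˡ X)
    (extend X empty (λ v∈X v~u _ → I-neighbour∈K (x∈∁p⇒x∉p (X⊆I v∈X)) v~u))

  extend-vertex : ∀ {F v} → Feasible F → v ∉ F → OuterInK F v → Feasible (F ∪ ⁅ v ⁆)
  extend-vertex fF v∉F out = add _ fF (outerInK⇒simplicial ⊆-refl out v∉F)

  Q₂ : Fin n → Subset n
  Q₂ k = ⁅ k ⁆ ∪ (N k ∩ I)

  Q₃ : Fin n → Fin n → Subset n
  Q₃ i k = fos i ∪ ⁅ k ⁆ ∪ ((N k ∩ I) ─ ⁅ i ⁆)

  private
    fos-bool⁻ : ∀ {i x} (d : Dec (x ∈ K)) (e : Dec (N x ⊆ N i)) (b : Bool) → adj i x ≡ b →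
                ((⌊ d ⌋ ∧ not b) ∨ (not ⌊ d ⌋ ∧ not ⌊ e ⌋)) ≡ true →
                (x ∈ K × ¬ i ~ x) ⊎ (x ∉ K × N x ⊈ N i)
    fos-bool⁻ (yes x∈K) _     false ix _ = inj₁ (x∈K , false⇒≁ ix)
    fos-bool⁻ (no x∉K)  (no ⊈) _     _  _ = inj₂ (x∉K , ⊈)
    fos-bool⁻ (yes _)   _     true  _ ()
    fos-bool⁻ (no _)    (yes _) _    _ ()

  fos⁻ : ∀ {i x} → x ∈ fos i → (x ∈ K × ¬ i ~ x) ⊎ (x ∉ K × N x ⊈ N i)
  fos⁻ {i} {x} x∈ = fos-bool⁻ (x ∈? K) (N x ⊆? N i) (adj i x) refl (∈-tabulate⁻ x∈)

  fos-K⁺ : ∀ {i x} → x ∈ K → ¬ i ~ x → x ∈ fos i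
  fos-K⁺ {i} {x} x∈K i≁x = ∈-tabulate⁺ (bool (x ∈? K) (N x ⊆? N i))
    where
    bool : (d : Dec (x ∈ K)) (e : Dec (N x ⊆ N i)) →
           ((⌊ d ⌋ ∧ not (adj i x)) ∨ (not ⌊ d ⌋ ∧ not ⌊ e ⌋)) ≡ true
    bool (yes _) _ rewrite ¬-not {adj i x} {true} i≁x = refl
    bool (no x∉K) _ = ⊥-elim (x∉K x∈K)

  fos-I⁺ : ∀ {i x} → x ∉ K → N x ⊈ N i → x ∈ fos i
  fos-I⁺ {i} {x} x∉K ⊈ = ∈-tabulate⁺ (bool (x ∈? K) (N x ⊆? N i))
    where
    bool : (d : Dec (x ∈ K)) (e : Dec (N x ⊆ N i)) →
           ((⌊ d ⌋ ∧ not (adj i x)) ∨ (not ⌊ d ⌋ ∧ not ⌊ e ⌋)) ≡ true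
    bool (yes x∈K) _ = ⊥-elim (x∉K x∈K)
    bool (no _) (yes ⊆) = ⊥-elim (⊈ ⊆)
    bool (no _) (no _) = refl

  data Q₃-member (i k x : Fin n) : Set where
    root        : x ≡ k → Q₃-member i k x
    far-clique  : x ∈ K → ¬ i ~ x → Q₃-member i k x
    undominated : x ∉ K → N x ⊈ N i → Q₃-member i k x
    pendant     : x ∉ K → k ~ x → x ≢ i → Q₃-member i k x

  Q₃-member⁻ : ∀ {i k x} → x ∈ Q₃ i k → Q₃-member i k x
  Q₃-member⁻ {i} {k} {x} x∈ with x∈p∪q⁻ (fos i) _ x∈
  ... | inj₁ x∈fos with fos⁻ x∈fos
  ...   | inj₁ (x∈K , i≁x)  = far-clique x∈K i≁x
  ...   | inj₂ (x∉K , ⊈)    = undominated x∉K ⊈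
  Q₃-member⁻ {i} {k} {x} x∈ | inj₂ x∈rest with x∈p∪q⁻ ⁅ k ⁆ _ x∈rest
  ... | inj₁ x∈⁅k⁆ = root (x∈⁅y⁆⇒x≡y k x∈⁅k⁆)
  ... | inj₂ x∈pend with x∈p∩q⁻ (N k ∩ I) (∁ ⁅ i ⁆) x∈pend
  ...   | x∈NI , x∉⁅i⁆ with x∈p∩q⁻ (N k) I x∈NI
  ...     | x∈Nk , x∈I = pendant (x∈∁p⇒x∉p x∈I) (∈N⁻ x∈Nk)
                                 (λ { refl → x∈∁p⇒x∉p x∉⁅i⁆ (x∈⁅x⁆ i) })

  Q₃-member⁺ : ∀ {i k x} → Q₃-member i k x → x ∈ Q₃ i k
  Q₃-member⁺ (root refl) = x∈p∪q⁺ (inj₂ (x∈p∪q⁺ (inj₁ (x∈⁅x⁆ _))))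
  Q₃-member⁺ (far-clique x∈K i≁x) = x∈p∪q⁺ (inj₁ (fos-K⁺ x∈K i≁x))
  Q₃-member⁺ (undominated x∉K ⊈) = x∈p∪q⁺ (inj₁ (fos-I⁺ x∉K ⊈))
  Q₃-member⁺ {i} (pendant x∉K k~x x≢i) = x∈p∪q⁺ (inj₂ (x∈p∪q⁺ (inj₂
    (x∈p∩q⁺ (x∈p∩q⁺ (∈N⁺ k~x , x∉p⇒x∈∁p x∉K) ,
             x∉p⇒x∈∁p (x≢i ∘ x∈⁅y⁆⇒x≡y i))))))

  i∉Q₃ : ∀ {i k} → i ∉ K → i ~ k → i ∉ Q₃ i k
  i∉Q₃ i∉K i~k i∈ with Q₃-member⁻ i∈
  ... | root refl = i∉K (I-neighbour∈K i∉K i~k)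
  ... | far-clique i∈K _ = i∉K i∈K
  ... | undominated _ ⊈ = ⊈ id
  ... | pendant _ _ i≢i = i≢i refl

  feasible-Q₁ : ∀ {i} → i ∈ I → Feasible ⁅ i ⁆
  feasible-Q₁ i∈I = independent-feasible (singleton⊆ i∈I)

  -- Shell N(k) ∩ I, then k.
  feasible-Q₂ : ∀ {k} → k ∈ K → Feasible (Q₂ k)
  feasible-Q₂ {k} k∈K = subst Feasible (∪-comm (N k ∩ I) ⁅ k ⁆)
    (extend-vertex (independent-feasible (p∩q⊆q (N k) I))
                   (λ k∈ → x∈∁p⇒x∉p (proj₂ (x∈p∩q⁻ (N k) I k∈)) k∈K)
                   outer)
    where
    outer : OuterInK (N k ∩ I) k
    outer k~u u∉ = ∈-stable (λ u∉K → u∉ (x∈p∩q⁺ (∈N⁺ k~u , x∉p⇒x∈∁p u∉K)))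

  far : Fin n → Subset n
  far i = K ─ N i

  far⁺ : ∀ {i x} → x ∈ K → ¬ i ~ x → x ∈ far i
  far⁺ x∈K i≁x = x∈p∩q⁺ (x∈K , x∉p⇒x∈∁p (i≁x ∘ ∈N⁻))

  far⁻ : ∀ {i x} → x ∈ far i → x ∈ K × ¬ i ~ x
  far⁻ {i} x∈ with x∈p∩q⁻ K (∁ (N i)) x∈
  ... | x∈K , x∉Ni = x∈K , x∈∁p⇒x∉p x∉Ni ∘ ∈N⁺

  Q₃-layers : ∀ {i k} → ((Q₃ i k ∩ I) ∪ far i) ∪ ⁅ k ⁆ ≡ Q₃ i k
  Q₃-layers {i} {k} = ⊆-antisym
    (∪-least (∪-least (p∩q⊆p (Q₃ i k) I) far⊆Q₃) (singleton⊆ (Q₃-member⁺ (root refl))))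
    Q₃⊆
    where
    far⊆Q₃ : far i ⊆ Q₃ i k
    far⊆Q₃ x∈ = Q₃-member⁺ (far-clique (proj₁ (far⁻ x∈)) (proj₂ (far⁻ x∈)))

    Q₃⊆ : Q₃ i k ⊆ ((Q₃ i k ∩ I) ∪ far i) ∪ ⁅ k ⁆
    Q₃⊆ {x} x∈ with x ∈? K | Q₃-member⁻ x∈
    ... | no x∉K  | _                 = p⊆p∪q ⁅ k ⁆ (p⊆p∪q (far i) (x∈p∩q⁺ (x∈ , x∉p⇒x∈∁p x∉K)))
    ... | yes _   | root refl         = q⊆p∪q _ ⁅ k ⁆ (x∈⁅x⁆ k)
    ... | yes x∈K | far-clique _ i≁x  = p⊆p∪q ⁅ k ⁆ (q⊆p∪q (Q₃ i k ∩ I) (far i) (far⁺ x∈K i≁x))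
    ... | yes x∈K | undominated x∉K _ = ⊥-elim (x∉K x∈K)
    ... | yes x∈K | pendant x∉K _ _   = ⊥-elim (x∉K x∈K)

  -- Once the independent part of Q₃(i,k) and the clique vertices missed by i
  -- are shelled, the unshelled neighbours of k are i and clique neighbours
  -- of i, which form a clique.
  Q₃-root-simplicial : ∀ {i k} → i ∉ K → i ~ k → SimplicialIn ((Q₃ i k ∩ I) ∪ far i) k
  Q₃-root-simplicial {i} {k} i∉K i~k = k∉S , k-simplicial
    where
    S : Subset n
    S = (Q₃ i k ∩ I) ∪ far i

    k∉S : k ∉ S
    k∉S k∈ with x∈p∪q⁻ (Q₃ i k ∩ I) (far i) k∈
    ... | inj₁ k∈Q₃I = x∈∁p⇒x∉p (proj₂ (x∈p∩q⁻ (Q₃ i k) I k∈Q₃I)) (I-neighbour∈K i∉K i~k)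
    ... | inj₂ k∈far = proj₂ (far⁻ k∈far) i~k

    unshelled : ∀ {u} → u ∉ S → k ~ u → u ≡ i ⊎ (u ∈ K × i ~ u)
    unshelled {u} u∉S k~u with u ∈? K | u ≟ i
    ... | no _    | yes u≡i = inj₁ u≡i
    ... | no u∉K  | no u≢i  = ⊥-elim (u∉S (p⊆p∪q (far i)
                                (x∈p∩q⁺ (Q₃-member⁺ (pendant u∉K k~u u≢i) , x∉p⇒x∈∁p u∉K))))
    ... | yes u∈K | _       = inj₂ (u∈K , decidable-stable (adj i u Bool.≟ true)
                                (λ i≁u → u∉S (q⊆p∪q (Q₃ i k ∩ I) (far i) (far⁺ u∈K i≁u))))

    k-simplicial : ∀ u w → u ∉ S → w ∉ S → k ~ u → k ~ w → u ≢ w → u ~ w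
    k-simplicial u w u∉ w∉ k~u k~w u≢w with unshelled u∉ k~u | unshelled w∉ k~w
    ... | inj₁ refl      | inj₁ refl      = ⊥-elim (u≢w refl)
    ... | inj₁ refl      | inj₂ (_ , i~w) = i~w
    ... | inj₂ (_ , i~u) | inj₁ refl      = ~-sym i~u
    ... | inj₂ (u∈K , _) | inj₂ (w∈K , _) = clique u w u∈K w∈K u≢w

  -- Shell the independent part of Q₃(i,k), then the clique vertices missed by
  -- i (their independent neighbours are undominated, so already shelled), and
  -- finally k.
  feasible-Q₃ : ∀ {i k} → i ∉ K → i ~ k → Feasible (Q₃ i k)
  feasible-Q₃ {i} {k} i∉K i~k = subst Feasible Q₃-layers
    (add k (extend (far i) (independent-feasible (p∩q⊆q (Q₃ i k) I)) far-outer)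
           (Q₃-root-simplicial i∉K i~k))
    where
    far-outer : ∀ {v} → v ∈ far i → OuterInK (Q₃ i k ∩ I) v
    far-outer v∈ v~u u∉ = ∈-stable λ u∉K → u∉ (x∈p∩q⁺ (Q₃-member⁺ (undominated u∉K
      (λ Nu⊆Ni → proj₂ (far⁻ v∈) (∈N⁻ (Nu⊆Ni (∈N⁺ (~-sym v~u)))))) , x∉p⇒x∈∁p u∉K))

  P-feasible : ∀ {Q} → InP Q → Feasible Q
  P-feasible (inj₁ (i , i∈I , refl))                   = feasible-Q₁ i∈I
  P-feasible (inj₂ (inj₁ (k , k∈K , refl)))            = feasible-Q₂ k∈K
  P-feasible (inj₂ (inj₂ (i , k , i∈I , k∈Ni , refl))) = feasible-Q₃ (x∈∁p⇒x∉p i∈I) (∈N⁻ k∈Ni)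

  Q₃-absorbed : ∀ {S i k} → Feasible S → i ∉ K → i ~ k → i ∉ S → SimplicialIn S k →
                Q₃ i k ⊆ S ∪ ⁅ k ⁆
  Q₃-absorbed {S} {i} {k} fS i∉K i~k i∉S (k∉S , k-simp) x∈ = absorb (Q₃-member⁻ x∈)
    where
    k~i : k ~ i
    k~i = ~-sym i~k

    k∈K : k ∈ K
    k∈K = I-neighbour∈K i∉K i~k

    -- i and an unshelled independent neighbour j of k would have to be adjacent
    pendant-shelled : ∀ {j} → j ∉ K → k ~ j → j ≢ i → j ∈ S
    pendant-shelled j∉K k~j j≢i = ∈-stable λ j∉S →
      I-nonadjacent i∉K j∉K (k-simp _ _ i∉S j∉S k~i k~j (j≢i ∘ sym))

    -- an unshelled clique vertex y ≠ k would have to be adjacent to i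
    far-shelled : ∀ {y} → y ∈ K → ¬ i ~ y → y ∈ S
    far-shelled {y} y∈K i≁y = ∈-stable λ y∉S →
      i≁y (k-simp _ _ i∉S y∉S k~i (clique k y k∈K y∈K (λ { refl → i≁y i~k })) (K≢I y∈K i∉K ∘ sym))

    -- if j ∉ S has a neighbour y missed by i, then y was shelled while j and
    -- k were both unshelled, so j ~ k
    through-far : ∀ {j y} → j ∉ K → y ∈ K → j ~ y → ¬ i ~ y → j ∉ S → j ~ k
    through-far {j} {y} j∉K y∈K j~y i≁y j∉S with shelling-stage fS (far-shelled y∈K i≁y)
    ... | S′ , _ , S′⊆S , (_ , y-simp) =
      y-simp j k (j∉S ∘ S′⊆S) (k∉S ∘ S′⊆S) (~-sym j~y)
             (clique y k y∈K k∈K (λ { refl → i≁y i~k })) (K≢I k∈K j∉K ∘ sym)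

    undominated-shelled : ∀ {j} → j ∉ K → N j ⊈ N i → j ∈ S
    undominated-shelled {j} j∉K Nj⊈Ni with ⊈-witness Nj⊈Ni
    ... | y , y∈Nj , y∉Ni = ∈-stable λ j∉S →
      j∉S (pendant-shelled j∉K
             (~-sym (through-far j∉K y∈K (∈N⁻ y∈Nj) (y∉Ni ∘ ∈N⁺) j∉S))
             (λ { refl → Nj⊈Ni id }))
      where
      y∈K : y ∈ K
      y∈K = I-neighbour∈K j∉K (∈N⁻ y∈Nj)

    absorb : ∀ {x} → Q₃-member i k x → x ∈ S ∪ ⁅ k ⁆
    absorb (root refl)              = q⊆p∪q S ⁅ k ⁆ (x∈⁅x⁆ k)
    absorb (far-clique x∈K i≁x)     = p⊆p∪q ⁅ k ⁆ (far-shelled x∈K i≁x)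
    absorb (undominated x∉K Nx⊈Ni)  = p⊆p∪q ⁅ k ⁆ (undominated-shelled x∉K Nx⊈Ni)
    absorb (pendant x∉K k~x x≢i)    = p⊆p∪q ⁅ k ⁆ (pendant-shelled x∉K k~x x≢i)

  -- If a clique vertex k is simplicial after a set S of independent vertices,
  -- every independent neighbour j of k is in S: otherwise j would be adjacent
  -- to all of K.  This is where the hypothesis N(i) ≠ K is used.
  Q₂-absorbed : (∀ i → i ∈ I → N i ≢ K) →
                ∀ {S k} → k ∈ K → S ⊆ I → SimplicialIn S k → Q₂ k ⊆ S ∪ ⁅ k ⁆
  Q₂-absorbed noFull {S} {k} k∈K S⊆I (_ , k-simp) =
    ∪-least (q⊆p∪q S ⁅ k ⁆) (p⊆p∪q ⁅ k ⁆ ∘ I-neighbours-shelled)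
    where
    sees-clique : ∀ {j} → j ∉ K → j ∉ S → k ~ j → K ⊆ N j
    sees-clique {j} j∉K j∉S k~j {y} y∈K with y ≟ k
    ... | yes refl = ∈N⁺ (~-sym k~j)
    ... | no y≢k = ∈N⁺ (k-simp j y j∉S (λ y∈S → x∈∁p⇒x∉p (S⊆I y∈S) y∈K) k~j
                                (clique k y k∈K y∈K (y≢k ∘ sym)) (K≢I y∈K j∉K ∘ sym))

    I-neighbours-shelled : N k ∩ I ⊆ S
    I-neighbours-shelled {j} j∈ with x∈p∩q⁻ (N k) I j∈
    ... | j∈Nk , j∈I = ∈-stable λ j∉S → noFull j j∈I
      (⊆-antisym (I-neighbour∈K j∉K ∘ ∈N⁻) (sees-clique j∉K j∉S (∈N⁻ j∈Nk)))
      where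
      j∉K : j ∉ K
      j∉K = x∈∁p⇒x∉p j∈I

  -- If x can be shelled right after a feasible F, some member of P
  -- containing x lies inside F ∪ {x}: ⁅ x ⁆ if x is independent, Q₃(i,x) if
  -- x has an unshelled independent neighbour i, and Q₂(x) otherwise.
  P-member-below : ∀ {F x} → Feasible F → SimplicialIn F x →
                   ∃[ Q ] (InP Q × x ∈ Q × Q ⊆ F ∪ ⁅ x ⁆)
  P-member-below {F} {x} fF simp with x ∈? K
  ... | no x∉K = ⁅ x ⁆ , inj₁ (x , x∉p⇒x∈∁p x∉K , refl) , x∈⁅x⁆ x , q⊆p∪q F ⁅ x ⁆
  ... | yes x∈K
    with any? {P = λ j → j ∉ K × x ~ j × j ∉ F}
              (λ j → ¬? (j ∈? K) ×-dec (adj x j Bool.≟ true) ×-dec ¬? (j ∈? F))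
  ...   | yes (i , i∉K , x~i , i∉F) =
          Q₃ i x , inj₂ (inj₂ (i , x , x∉p⇒x∈∁p i∉K , ∈N⁺ (~-sym x~i) , refl)) ,
          Q₃-member⁺ (root refl) , Q₃-absorbed fF i∉K (~-sym x~i) i∉F simp
  ...   | no none =
          Q₂ x , inj₂ (inj₁ (x , x∈K , refl)) , x∈p∪q⁺ (inj₁ (x∈⁅x⁆ x)) ,
          ∪-least (q⊆p∪q F ⁅ x ⁆) (p⊆p∪q ⁅ x ⁆ ∘ I-neighbours-shelled)
    where
    I-neighbours-shelled : N x ∩ I ⊆ F
    I-neighbours-shelled {j} j∈ with x∈p∩q⁻ (N x) I j∈
    ... | j∈Nx , j∈I = ∈-stable λ j∉F → none (j , x∈∁p⇒x∉p j∈I , ∈N⁻ j∈Nx , j∉F)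

  -- A feasible Q containing x is a path if every feasible stage S ⊆ Q after
  -- which x is simplicial already contains Q ∖ {x}: then every feasible
  -- subset of Q containing x is Q itself, so Q is no union of two proper ones.
  path-criterion : ∀ {Q x} → Feasible Q → x ∈ Q →
                   (∀ {S} → Feasible S → S ⊆ Q → SimplicialIn S x → Q ⊆ S ∪ ⁅ x ⁆) →
                   IsPath Q
  path-criterion {Q} {x} fQ x∈Q absorbed = fQ , (x , x∈Q) , no-split
    where
    rooted : ∀ {A} → Feasible A → A ⊆ Q → x ∈ A → A ≡ Q
    rooted fA A⊆Q x∈A with shelling-stage fA x∈A
    ... | S , fS , S⊆A , simp =
      ⊆-antisym A⊆Q (∪-least S⊆A (singleton⊆ x∈A) ∘ absorbed fS (A⊆Q ∘ S⊆A) simp)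

    no-split : ¬ (∃[ A ] ∃[ C ] (Feasible A × Feasible C × A ≢ Q × C ≢ Q × A ∪ C ≡ Q))
    no-split (A , C , fA , fC , A≢Q , C≢Q , A∪C≡Q)
      with x∈p∪q⁻ A C (subst (x ∈_) (sym A∪C≡Q) x∈Q)
    ... | inj₁ x∈A = A≢Q (rooted fA (subst (A ∪ C ⊆_) A∪C≡Q ⊆-refl ∘ p⊆p∪q C) x∈A)
    ... | inj₂ x∈C = C≢Q (rooted fC (subst (A ∪ C ⊆_) A∪C≡Q ⊆-refl ∘ q⊆p∪q A C) x∈C)

  -- If the path F ∪ {x} arises by shelling x after F, it is the only feasible
  -- Q with x ∈ Q ⊆ F ∪ {x}: otherwise Q and F split it.
  path-last-step : ∀ {F x Q} → IsPath (F ∪ ⁅ x ⁆) → Feasible F → x ∉ F →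
                   Feasible Q → x ∈ Q → Q ⊆ F ∪ ⁅ x ⁆ → Q ≡ F ∪ ⁅ x ⁆
  path-last-step {F} {x} {Q} (_ , _ , no-split) fF x∉F fQ x∈Q Q⊆
    with ≡-dec Bool._≟_ Q (F ∪ ⁅ x ⁆)
  ... | yes Q≡ = Q≡
  ... | no Q≢ = ⊥-elim (no-split (Q , F , fQ , fF , Q≢ , F≢ , Q∪F≡))
    where
    F≢ : F ≢ F ∪ ⁅ x ⁆
    F≢ F≡ = x∉F (subst (x ∈_) (sym F≡) (q⊆p∪q F ⁅ x ⁆ (x∈⁅x⁆ x)))

    Q∪F≡ : Q ∪ F ≡ F ∪ ⁅ x ⁆
    Q∪F≡ = ⊆-antisym (∪-least Q⊆ (p⊆p∪q ⁅ x ⁆))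
                     (∪-least (q⊆p∪q Q F) (singleton⊆ (p⊆p∪q F x∈Q)))

  path⇒P : ∀ {F} → IsPath F → InP F
  path⇒P (empty , (_ , x∈⊥) , _) = ⊥-elim (∉⊥ x∈⊥)
  path⇒P path@(add x fF simp , _) with P-member-below fF simp
  ... | Q , Q∈P , x∈Q , Q⊆ =
    subst InP (path-last-step path fF (proj₁ simp) (P-feasible Q∈P) x∈Q Q⊆) Q∈P

  P⇒path : (∀ i → i ∈ I → N i ≢ K) → ∀ {F} → InP F → IsPath F
  P⇒path _ (inj₁ (i , i∈I , refl)) =
    path-criterion (feasible-Q₁ i∈I) (x∈⁅x⁆ i) (λ {S} _ _ _ → q⊆p∪q S ⁅ i ⁆)
  P⇒path noFull (inj₂ (inj₁ (k , k∈K , refl))) =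
    path-criterion (feasible-Q₂ k∈K) (x∈p∪q⁺ (inj₁ (x∈⁅x⁆ k)))
      (λ _ S⊆Q₂ simp → Q₂-absorbed noFull k∈K (before-root S⊆Q₂ (proj₁ simp)) simp)
    where
    before-root : ∀ {S} → S ⊆ Q₂ k → k ∉ S → S ⊆ I
    before-root S⊆Q₂ k∉S y∈S with x∈p∪q⁻ ⁅ k ⁆ (N k ∩ I) (S⊆Q₂ y∈S)
    ... | inj₁ y∈⁅k⁆ = ⊥-elim (k∉S (subst (_∈ _) (x∈⁅y⁆⇒x≡y k y∈⁅k⁆) y∈S))
    ... | inj₂ y∈NI  = proj₂ (x∈p∩q⁻ (N k) I y∈NI)
  P⇒path _ (inj₂ (inj₂ (i , k , i∈I , k∈Ni , refl))) =
    path-criterion (feasible-Q₃ i∉K i~k) (Q₃-member⁺ (root refl))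
      (λ fS S⊆Q₃ simp → Q₃-absorbed fS i∉K i~k (i∉Q₃ i∉K i~k ∘ S⊆Q₃) simp)
    where
    i∉K : i ∉ K
    i∉K = x∈∁p⇒x∉p i∈I

    i~k : i ~ k
    i~k = ∈N⁻ k∈Ni

mainTheorem10 : ∀ {n : ℕ} (G : SplitGraph n) →
    (∀ i → i ∈ SplitGraph.I G → SplitGraph.N G i ≢ SplitGraph.K G) →
    ∀ F → (SplitGraph.IsPath G F → SplitGraph.InP G F) × (SplitGraph.InP G F → SplitGraph.IsPath G F)
mainTheorem10 G noFull F = Shelling.path⇒P G , Shelling.P⇒path G noFull
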